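{- Let $\mathcal{S}=(\Gamma^1,\dots,\Gamma^k)$ be a uniform transportation schedule, let $\mathrm{TR}$ be a set of uniform transport requests with an assignment as described in the context, let $G^{tm}$ be the corresponding transport schedule graph, and let $G^s$ be the tour connection graph for $G^{tm}$. Then (1) every connected component of $G^s$ is strongly connected, and (2) if every tour in $\mathcal{S}$ is a tour with backhaul, then every connected component of $G^{tm}$ is strongly connected.
   Context: An action $(j,v,t,x)$ of driver $j$ loads $x>0$ or unloads $|x|$ ($x<0$) cars at station $v$, $|x|\le L$; a move carries between $0$ and $L$ cars from one station to another. A tour of driver $j$ is an alternating sequence of moves and actions with consistent locations and times and load of each move equal to the load of the previous move plus the $x$ of the action in between; it starts at the driver's depot $v_D^j$ with an empty convoy and ends at a depot with an empty convoy; it is with backhaul if it ends at $v_D^j$. A transportation schedule is a collection of one tour per driver; it is uniform if every action in every tour has $x\in\{1,-1\}$. Schedule graph of $\mathcal{S}$: nodes are the pickup actions and drop actions of all tours plus, for each tour $j$, a depot node $(j,v_D^j,0)$; schedule tour arcs join consecutive actions of the same tour, the depot node of tour $j$ to its first action, and its last action to its depot node. A uniform transport request is $(v,v',1)$; each request in $\mathrm{TR}$ is assigned to a pickup action at $v$ and a drop action at $v'$ of the schedule, every action being assigned to exactly one request. The transport schedule graph $G^{tm}$ adds a transport arc from the assigned pickup node to the assigned drop node of each request. The tour connection graph $G^s$ has one node per tour and, for every request whose assigned pickup action lies in tour $\Gamma^i$ and assigned drop action in tour $\Gamma^j$ with $i\ne j$, an arc from $\Gamma^i$ to $\Gamma^j$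 (parallel arcs allowed). Connected components are weakly connected components. -}

module Defs where

open import Data.Nat using (ℕ; zero; suc; _≤_)
open import Data.Integer as ℤ using (ℤ; +_; -[1+_]; 0ℤ; ∣_∣)
open import Data.Fin using (Fin; zero; suc; toℕ; inject₁; fromℕ)
open import Data.Maybe using (Maybe; just; nothing)
open import Data.Product using (Σ; ∃; ∃-syntax; _×_; _,_; proj₁; proj₂)
open import Data.Sum using (_⊎_)
open import Relation.Binary.PropositionalEquality using (_≡_; _≢_)
open import Relation.Binary.Construct.Closure.ReflexiveTransitive using (Star)
open import Relation.Binary.Construct.Closure.Symmetric using (SymClosure)

record Action (V : Set) : Set where
  field
    station : V
    time    : ℕ
    x       : ℤ          -- x > 0: load x cars, x < 0: unload |x| cars
open Action public

record Move (V : Set) : Set where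
  field
    from    : V
    to      : V
    depTime : ℕ
    arrTime : ℕ
    load    : ℕ
open Move public

ValidAction : {V : Set} → ℕ → Action V → Set
ValidAction L a = (x a ≢ 0ℤ) × (∣ x a ∣ ≤ L)

ValidMove : {V : Set} → ℕ → Move V → Set
ValidMove L m = (load m ≤ L) × (depTime m ≤ arrTime m)

-- A tour with n actions: moves m₀ a₀ m₁ a₁ … a_{n-1} m_n.
-- Action i lies between move (inject₁ i) and move (suc i).
record Tour (V : Set) (L : ℕ) (isDepot : V → Set) (home : V) : Set where
  field
    nActs   : ℕ
    actions : Fin nActs → Action V
    moves   : Fin (suc nActs) → Move V
    validA  : ∀ i → ValidAction L (actions i)
    validM  : ∀ i → ValidMove L (moves i)
    arrive  : ∀ i → to (moves (inject₁ i)) ≡ station (actions i)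
    arriveT : ∀ i → arrTime (moves (inject₁ i)) ≤ time (actions i)
    leave   : ∀ i → from (moves (suc i)) ≡ station (actions i)
    leaveT  : ∀ i → time (actions i) ≤ depTime (moves (suc i))
    loadEq  : ∀ i → + load (moves (suc i)) ≡ (+ load (moves (inject₁ i))) ℤ.+ x (actions i)
    start   : from (moves zero) ≡ home
    startE  : load (moves zero) ≡ 0
    end     : isDepot (to (moves (fromℕ nActs)))
    endE    : load (moves (fromℕ nActs)) ≡ 0
open Tour public

record Schedule (V : Set) (L k : ℕ) : Set where
  field
    depot : Fin k → V
    tour  : (j : Fin k) → Tour V L (λ v → ∃[ j' ] depot j' ≡ v) (depot j)
open Schedule public

module _ {V : Set} {L k : ℕ} (S : Schedule V L k) where

  nA : Fin k → ℕ
  nA j = nActs (tour S j)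

  act : (j : Fin k) → Fin (nA j) → Action V
  act j = actions (tour S j)

  Backhaul : Fin k → Set
  Backhaul j = to (moves (tour S j) (fromℕ (nA j))) ≡ depot S j

  AllBackhaul : Set
  AllBackhaul = ∀ j → Backhaul j

  Uniform : Set
  Uniform = ∀ j i → (x (act j i) ≡ + 1) ⊎ (x (act j i) ≡ -[1+ 0 ])

  ActPos : Set
  ActPos = Σ (Fin k) (λ j → Fin (nA j))

  actAt : ActPos → Action V
  actAt (j , i) = act j i

  IsPickup : ActPos → Set
  IsPickup p = 0ℤ ℤ.< x (actAt p)

  IsDrop : ActPos → Set
  IsDrop p = x (actAt p) ℤ.< 0ℤ

  -- Assignment of uniform transport requests TR (request q is (v,v',1),
  -- given as the pair (v , v')) to pickup and drop actions.
  record Assignment (r : ℕ) (TR : Fin r → V × V) : Set where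
    field
      pick     : Fin r → ActPos
      drop     : Fin r → ActPos
      pickOK   : ∀ q → IsPickup (pick q) × station (actAt (pick q)) ≡ proj₁ (TR q)
      dropOK   : ∀ q → IsDrop (drop q) × station (actAt (drop q)) ≡ proj₂ (TR q)
      assigned : ∀ p → ∃[ q ] ((pick q ≡ p ⊎ drop q ≡ p) ×
                   (∀ q' → (pick q' ≡ p ⊎ drop q' ≡ p) → q' ≡ q))
  open Assignment public

  -- Nodes of the schedule graph: (j , just i) is action i of tour j,
  -- (j , nothing) is the depot node (j , v_D^j , 0) of tour j.
  Node : Set
  Node = Σ (Fin k) (λ j → Data.Maybe.Maybe (Fin (nA j)))

  actNode : ActPos → Node
  actNode (j , i) = (j , just i)

  data TourArc : Node → Node → Set where
    depot→first : ∀ j (i : Fin (nA j)) → toℕ i ≡ 0 → TourArc (j , nothing) (j , just i)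
    consecutive : ∀ j (i i' : Fin (nA j)) → toℕ i' ≡ suc (toℕ i) →
                  TourArc (j , just i) (j , just i')
    last→depot  : ∀ j (i : Fin (nA j)) → suc (toℕ i) ≡ nA j → TourArc (j , just i) (j , nothing)

  module _ {r : ℕ} {TR : Fin r → V × V} (A : Assignment r TR) where

    TransportArc : Node → Node → Set
    TransportArc u w = ∃[ q ] (actNode (pick A q) ≡ u × actNode (drop A q) ≡ w)

    GtmArc : Node → Node → Set
    GtmArc u w = TourArc u w ⊎ TransportArc u w

    GsArc : Fin k → Fin k → Set
    GsArc i j = ∃[ q ] (proj₁ (pick A q) ≡ i × proj₁ (drop A q) ≡ j × i ≢ j)

-- Every weakly connected component of the digraph with arc relation E
-- is strongly connected: any two nodes joined by an undirected path are
-- joined by a directed path.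
ComponentsStronglyConnected : {N : Set} → (N → N → Set) → Set
ComponentsStronglyConnected E = ∀ u w → Star (SymClosure E) u w → Star E u w

-- Weak components of a digraph are strongly connected as soon as every arc
-- u → w can be walked back by a directed path w ⇝ u.
--
-- For the tour connection graph, let R be the set of tours reachable from w.
-- Weigh every action by the indicator of R on its tour times its load change x.
-- Summed tour by tour this is 0, since every tour starts and ends empty.
-- Summed request by request, each (uniform) request contributes
-- [pickup tour ∈ R] − [drop tour ∈ R], which is ≤ 0 because R is closed under
-- arcs.  Nonpositive summands of a zero sum vanish, so R is also closed
-- backwards along arcs, and in particular contains u.
--
-- In the transport schedule graph every tour is a cycle through its depot
-- node, so it suffices to walk back transport arcs; a transport arc from tour
-- i to tour j is walked back through a path j ⇝ i of tour connection arcs,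
-- each of which is a transport arc.
module Submission where

open import Defs
open import Data.Nat using (ℕ; zero; suc)
open import Data.Fin using (Fin; zero; suc; toℕ; inject₁; fromℕ)
open import Data.Fin.Properties using (_≟_; any?; suc-injective; toℕ-inject₁; toℕ-fromℕ)
open import Data.Fin.Induction using (<-weakInduction; >-weakInduction)
open import Data.Fin.Subset.Induction using (Acc; acc; ⊃-wellFounded)
open import Data.Fin.Subset using (Subset; _∈_; _⊆_; _⊃_; _∪_; ⁅_⁆)
open import Data.Fin.Subset.Properties using (_∈?_; x∈⁅x⁆; x∈⁅y⁆⇒x≡y; p⊆p∪q; q⊆p∪q; x∈p∪q⁻)
open import Data.Integer using (ℤ; +_; 0ℤ; 1ℤ; -1ℤ; _+_; _*_; _≤_; _<_; -≤+; +<+)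
import Data.Integer.Properties as ℤ
open import Data.Maybe using (Maybe; just; nothing)
open import Data.Product using (Σ; ∃-syntax; _×_; _,_; proj₁; proj₂)
open import Data.Product.Properties using (≡-dec)
open import Data.Sum using (_⊎_; inj₁; inj₂)
open import Function using (_∘_; id)
open import Relation.Nullary using (Dec; yes; no; ¬_; ¬?; contradiction)
open import Relation.Nullary.Decidable using (_×-dec_)
open import Relation.Binary.PropositionalEquality
open import Relation.Binary.Construct.Closure.ReflexiveTransitive using (Star; ε; _◅_; _◅◅_; gmap)
open import Relation.Binary.Construct.Closure.Symmetric using (fwd; bwd)
open import Algebra.Properties.Semiring.Sum ℤ.+-*-semiring
  using (sum; sum-syntax; sum-cong-≗; sum-replicate-zero; ∑-distrib-+; ∑-comm; *-distribˡ-sum)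

reversible⇒componentsStronglyConnected : {N : Set} (E : N → N → Set) →
  (∀ {u w} → E u w → Star E w u) → ComponentsStronglyConnected E
reversible⇒componentsStronglyConnected E reverse u .u ε = ε
reversible⇒componentsStronglyConnected E reverse u w (fwd e ◅ p) =
  e ◅ reversible⇒componentsStronglyConnected E reverse _ w p
reversible⇒componentsStronglyConnected E reverse u w (bwd e ◅ p) =
  reverse e ◅◅ reversible⇒componentsStronglyConnected E reverse _ w p

module _ {n : ℕ} (E : Fin n → Fin n → Set) where

  ForwardClosed BackwardClosed : Subset n → Set
  ForwardClosed R = ∀ {u v} → E u v → u ∈ R → v ∈ R
  BackwardClosed R = ∀ {u v} → E u v → v ∈ R → u ∈ R

  module _ (E? : ∀ u v → Dec (E u v)) (w : Fin n) where

    ReachableFrom : Subset n → Set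
    ReachableFrom R = ∀ {v} → v ∈ R → Star E w v

    -- Add one arc leaving R at a time; this terminates since R strictly grows.
    forwardClosure : ∀ R → Acc _⊃_ R → ReachableFrom R →
      ∃[ R′ ] (R ⊆ R′ × ForwardClosed R′ × ReachableFrom R′)
    forwardClosure R (acc larger) reach
      with any? (λ u → any? λ v → (u ∈? R) ×-dec (¬? (v ∈? R)) ×-dec E? u v)
    ... | no noExit = R , (λ v∈R → v∈R) , closed , reach
      where
      closed : ForwardClosed R
      closed {u} {v} e u∈R with v ∈? R
      ... | yes v∈R = v∈R
      ... | no v∉R = contradiction (u , v , u∈R , v∉R , e) noExit
    ... | yes (u , v , u∈R , v∉R , e)
      with forwardClosure (R ∪ ⁅ v ⁆) (larger R⊂R∪v) reach′
      where
      R⊂R∪v : (R ∪ ⁅ v ⁆) ⊃ R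
      R⊂R∪v = p⊆p∪q ⁅ v ⁆ , v , q⊆p∪q R ⁅ v ⁆ (x∈⁅x⁆ v) , v∉R
      reach′ : ReachableFrom (R ∪ ⁅ v ⁆)
      reach′ v′∈ with x∈p∪q⁻ R ⁅ v ⁆ v′∈
      ... | inj₁ v′∈R = reach v′∈R
      ... | inj₂ v′∈⁅v⁆ rewrite x∈⁅y⁆⇒x≡y v v′∈⁅v⁆ = reach u∈R ◅◅ (e ◅ ε)
    ... | R′ , R∪v⊆R′ , closed , reach″ = R′ , R∪v⊆R′ ∘ p⊆p∪q ⁅ v ⁆ , closed , reach″

    reachableForwardClosed : ∃[ R ] (w ∈ R × ForwardClosed R × ReachableFrom R)
    reachableForwardClosed with forwardClosure ⁅ w ⁆ (⊃-wellFounded _) singleton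
      where
      singleton : ReachableFrom ⁅ w ⁆
      singleton v∈⁅w⁆ rewrite x∈⁅y⁆⇒x≡y w v∈⁅w⁆ = ε
    ... | R , w⊆R , closed , reach = R , w⊆R (x∈⁅x⁆ w) , closed , reach

  forwardClosed⇒backwardClosed⇒reversible : (∀ u v → Dec (E u v)) →
    (∀ R → ForwardClosed R → BackwardClosed R) → ∀ {u w} → E u w → Star E w u
  forwardClosed⇒backwardClosed⇒reversible E? backward {u} {w} e
    with reachableForwardClosed E? w
  ... | R , w∈R , closed , reach = reach (backward R closed e w∈R)

cycle-stronglyConnected : ∀ {n} {E : Maybe (Fin n) → Maybe (Fin n) → Set} →
  (∀ i → toℕ i ≡ 0 → E nothing (just i)) →
  (∀ i i′ → toℕ i′ ≡ suc (toℕ i) → E (just i) (just i′)) →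
  (∀ i → suc (toℕ i) ≡ n → E (just i) nothing) →
  ∀ a b → Star E a b
cycle-stronglyConnected {zero} first next last nothing nothing = ε
cycle-stronglyConnected {suc n} {E} first next last a b = toDepot a ◅◅ fromDepot b
  where
  fromDepot : ∀ b → Star E nothing b
  fromDepot nothing = ε
  fromDepot (just i) = <-weakInduction (Star E nothing ∘ just) (first zero refl ◅ ε)
    (λ i p → p ◅◅ (next (inject₁ i) (suc i) (cong suc (sym (toℕ-inject₁ i))) ◅ ε)) i
  toDepot : ∀ a → Star E a nothing
  toDepot nothing = ε
  toDepot (just i) = >-weakInduction (λ i → Star E (just i) nothing)
    (last (fromℕ n) (cong suc (toℕ-fromℕ n)) ◅ ε)
    (λ i p → next (inject₁ i) (suc i) (cong suc (sym (toℕ-inject₁ i))) ◅ p) i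

sum-zero : ∀ {n} (f : Fin n → ℤ) → (∀ i → f i ≡ 0ℤ) → sum f ≡ 0ℤ
sum-zero {n} f f≡0 = trans (sum-cong-≗ f≡0) (sum-replicate-zero n)

sum-single : ∀ {n} (i : Fin n) {f : Fin n → ℤ} → (∀ j → j ≢ i → f j ≡ 0ℤ) → sum f ≡ f i
sum-single zero {f} f≡0 =
  trans (cong (_+_ (f zero)) (sum-zero (f ∘ suc) (λ j → f≡0 (suc j) λ ()))) (ℤ.+-identityʳ _)
sum-single (suc i) {f} f≡0 = trans (cong (_+ sum (f ∘ suc)) (f≡0 zero λ ()))
  (trans (ℤ.+-identityˡ _) (sum-single i (λ j j≢i → f≡0 (suc j) (j≢i ∘ suc-injective))))

sum-nonpositive : ∀ {n} {f : Fin n → ℤ} → (∀ i → f i ≤ 0ℤ) → sum f ≤ 0ℤ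
sum-nonpositive {zero} f≤0 = ℤ.≤-refl
sum-nonpositive {suc n} f≤0 = ℤ.+-mono-≤ (f≤0 zero) (sum-nonpositive (f≤0 ∘ suc))

nonpositive-+≡0⇒≡0 : ∀ {a b} → a ≤ 0ℤ → b ≤ 0ℤ → a + b ≡ 0ℤ → a ≡ 0ℤ
nonpositive-+≡0⇒≡0 {a} {b} a≤0 b≤0 a+b≡0 = ℤ.≤-antisym a≤0 (begin
  0ℤ     ≡⟨ sym a+b≡0 ⟩
  a + b  ≤⟨ ℤ.+-monoʳ-≤ a b≤0 ⟩
  a + 0ℤ ≡⟨ ℤ.+-identityʳ a ⟩
  a      ∎)
  where open ℤ.≤-Reasoning

nonpositive-sum≡0⇒≡0 : ∀ {n} {f : Fin n → ℤ} → (∀ i → f i ≤ 0ℤ) → sum f ≡ 0ℤ → ∀ i → f i ≡ 0ℤ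
nonpositive-sum≡0⇒≡0 {suc n} {f} f≤0 ∑f≡0 zero =
  nonpositive-+≡0⇒≡0 (f≤0 zero) (sum-nonpositive (f≤0 ∘ suc)) ∑f≡0
nonpositive-sum≡0⇒≡0 {suc n} {f} f≤0 ∑f≡0 (suc i) =
  nonpositive-sum≡0⇒≡0 (f≤0 ∘ suc) tail≡0 i
  where
  tail≡0 : sum (f ∘ suc) ≡ 0ℤ
  tail≡0 = nonpositive-+≡0⇒≡0 (sum-nonpositive (f≤0 ∘ suc)) (f≤0 zero)
    (trans (ℤ.+-comm _ (f zero)) ∑f≡0)

sum-telescope : ∀ n (a : Fin n → ℤ) (m : Fin (suc n) → ℤ) →
  (∀ i → m (suc i) ≡ m (inject₁ i) + a i) → m (fromℕ n) ≡ m zero + sum a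
sum-telescope zero a m step = sym (ℤ.+-identityʳ _)
sum-telescope (suc n) a m step = begin
  m (fromℕ (suc n))                  ≡⟨ sum-telescope n (a ∘ suc) (m ∘ suc) (step ∘ suc) ⟩
  m (suc zero) + sum (a ∘ suc)       ≡⟨ cong (_+ sum (a ∘ suc)) (step zero) ⟩
  (m zero + a zero) + sum (a ∘ suc)  ≡⟨ ℤ.+-assoc (m zero) (a zero) _ ⟩
  m zero + sum a                     ∎
  where open ≡-Reasoning

𝟙 : {P : Set} → Dec P → ℤ
𝟙 (yes _) = 1ℤ
𝟙 (no _) = 0ℤ

𝟙-yes : {P : Set} → P → (p : Dec P) → 𝟙 p ≡ 1ℤ
𝟙-yes _ (yes _) = refl
𝟙-yes x (no ¬x) = contradiction x ¬x

𝟙-no : {P : Set} → ¬ P → (p : Dec P) → 𝟙 p ≡ 0ℤ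
𝟙-no ¬x (yes x) = contradiction x ¬x
𝟙-no _ (no _) = refl

-- The weighted load change of one uniform request: a pickup (x = 1) weighted by
-- 𝟙 p and a drop (x = -1) weighted by 𝟙 q.
unitPair : {P Q : Set} → Dec P → Dec Q → ℤ
unitPair p q = 𝟙 p * 1ℤ + 𝟙 q * -1ℤ

unitPair≤0 : {P Q : Set} → (P → Q) → (p : Dec P) (q : Dec Q) → unitPair p q ≤ 0ℤ
unitPair≤0 P⇒Q (yes _) (yes _) = ℤ.≤-refl
unitPair≤0 P⇒Q (yes x) (no ¬y) = contradiction (P⇒Q x) ¬y
unitPair≤0 P⇒Q (no _) (yes _) = -≤+
unitPair≤0 P⇒Q (no _) (no _) = ℤ.≤-refl

unitPair≡0⇒ : {P Q : Set} (p : Dec P) (q : Dec Q) → unitPair p q ≡ 0ℤ → Q → P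
unitPair≡0⇒ (yes x) q _ _ = x
unitPair≡0⇒ (no _) (yes _) () _
unitPair≡0⇒ (no _) (no ¬y) _ y = contradiction y ¬y

module _ {k : ℕ} {n : Fin k → ℕ} where

  ∑Σ : (Σ (Fin k) (Fin ∘ n) → ℤ) → ℤ
  ∑Σ f = ∑[ j < k ] ∑[ i < n j ] f (j , i)

  ∑Σ-cong : ∀ {f g} → (∀ p → f p ≡ g p) → ∑Σ f ≡ ∑Σ g
  ∑Σ-cong f≡g = sum-cong-≗ (λ j → sum-cong-≗ (λ i → f≡g (j , i)))

  ∑Σ-distrib-+ : ∀ f g → ∑Σ (λ p → f p + g p) ≡ ∑Σ f + ∑Σ g
  ∑Σ-distrib-+ f g =
    trans (sum-cong-≗ (λ j → ∑-distrib-+ (λ i → f (j , i)) (λ i → g (j , i))))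
          (∑-distrib-+ (λ j → ∑[ i < n j ] f (j , i)) (λ j → ∑[ i < n j ] g (j , i)))

  ∑Σ-single : ∀ a {f} → (∀ p → p ≢ a → f p ≡ 0ℤ) → ∑Σ f ≡ f a
  ∑Σ-single (j , i) f≡0 =
    trans (sum-single j (λ j′ j′≢j → sum-zero _ (λ i′ → f≡0 (j′ , i′) (j′≢j ∘ cong proj₁))))
          (sum-single i (λ i′ i′≢i → f≡0 (j , i′) λ { refl → i′≢i refl }))

  _≟Σ_ : (p p′ : Σ (Fin k) (Fin ∘ n)) → Dec (p ≡ p′)
  _≟Σ_ = ≡-dec _≟_ _≟_

  ∑Σ-reindex : ∀ {r} (pick drop : Fin r → Σ (Fin k) (Fin ∘ n)) →
    (∀ p → ∑[ q < r ] (𝟙 (pick q ≟Σ p) + 𝟙 (drop q ≟Σ p)) ≡ 1ℤ) →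
    ∀ f → ∑Σ f ≡ ∑[ q < r ] (f (pick q) + f (drop q))
  ∑Σ-reindex {r} pick drop once f = begin
    ∑Σ f
      ≡⟨ ∑Σ-cong (λ p → sym (weighted p)) ⟩
    ∑Σ (λ p → ∑[ q < r ] (f p * δ q p))
      ≡⟨ sum-cong-≗ (λ j → ∑-comm (λ i q → f (j , i) * δ q (j , i))) ⟩
    ∑[ j < k ] ∑[ q < r ] ∑[ i < n j ] (f (j , i) * δ q (j , i))
      ≡⟨ ∑-comm (λ j q → ∑[ i < n j ] (f (j , i) * δ q (j , i))) ⟩
    ∑[ q < r ] ∑Σ (λ p → f p * δ q p)
      ≡⟨ sum-cong-≗ split ⟩
    ∑[ q < r ] (f (pick q) + f (drop q))
      ∎
    where
    open ≡-Reasoning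
    δ : Fin r → Σ (Fin k) (Fin ∘ n) → ℤ
    δ q p = 𝟙 (pick q ≟Σ p) + 𝟙 (drop q ≟Σ p)
    weighted : ∀ p → ∑[ q < r ] (f p * δ q p) ≡ f p
    weighted p = trans (sym (*-distribˡ-sum (f p) (λ q → δ q p)))
                       (trans (cong (f p *_) (once p)) (ℤ.*-identityʳ (f p)))
    at : ∀ a → ∑Σ (λ p → f p * 𝟙 (a ≟Σ p)) ≡ f a
    at a = trans (∑Σ-single a elsewhere) (trans (cong (f a *_) (𝟙-yes refl (a ≟Σ a))) (ℤ.*-identityʳ (f a)))
      where
      elsewhere : ∀ p → p ≢ a → f p * 𝟙 (a ≟Σ p) ≡ 0ℤ
      elsewhere p p≢a = trans (cong (f p *_) (𝟙-no (p≢a ∘ sym) (a ≟Σ p))) (ℤ.*-zeroʳ (f p))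
    split : ∀ q → ∑Σ (λ p → f p * δ q p) ≡ f (pick q) + f (drop q)
    split q = trans (∑Σ-cong (λ p → ℤ.*-distribˡ-+ (f p) _ _))
                    (trans (∑Σ-distrib-+ _ _) (cong₂ _+_ (at (pick q)) (at (drop q))))

module Transport {V : Set} {L k : ℕ} (S : Schedule V L k) (uniform : Uniform S)
                 {r : ℕ} {TR : Fin r → V × V} (A : Assignment S r TR) where

  Gs = GsArc S A
  Gtm = GtmArc S A

  tourOf : ActPos S → Fin k
  tourOf = proj₁

  tour-balanced : ∀ j → ∑[ i < nA S j ] x (act S j i) ≡ 0ℤ
  tour-balanced j = sym (begin
    0ℤ                                 ≡⟨ cong +_ (sym (endE T)) ⟩
    + load (moves T (fromℕ (nA S j)))  ≡⟨ sum-telescope (nA S j) _ (+_ ∘ load ∘ moves T) (loadEq T) ⟩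
    + load (moves T zero) + ∑x         ≡⟨ cong (λ l → + l + ∑x) (startE T) ⟩
    0ℤ + ∑x                            ≡⟨ ℤ.+-identityˡ ∑x ⟩
    ∑x                                 ∎)
    where
    open ≡-Reasoning
    T = tour S j
    ∑x = ∑[ i < nA S j ] x (act S j i)

  pick≢drop : ∀ q q′ → pick A q ≢ drop A q′
  pick≢drop q q′ eq =
    ℤ.<-asym (proj₁ (pickOK A q)) (subst (IsDrop S) (sym eq) (proj₁ (dropOK A q′)))

  assigned-once : ∀ p → ∑[ q < r ] (𝟙 (pick A q ≟Σ p) + 𝟙 (drop A q ≟Σ p)) ≡ 1ℤ
  assigned-once p with assigned A p
  ... | q₀ , hit , unique = trans (sum-single q₀ elsewhere) (at hit)
    where
    elsewhere : ∀ q → q ≢ q₀ → 𝟙 (pick A q ≟Σ p) + 𝟙 (drop A q ≟Σ p) ≡ 0ℤ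
    elsewhere q q≢q₀ = cong₂ _+_ (𝟙-no (q≢q₀ ∘ unique q ∘ inj₁) (pick A q ≟Σ p))
                                 (𝟙-no (q≢q₀ ∘ unique q ∘ inj₂) (drop A q ≟Σ p))
    at : (pick A q₀ ≡ p) ⊎ (drop A q₀ ≡ p) → 𝟙 (pick A q₀ ≟Σ p) + 𝟙 (drop A q₀ ≟Σ p) ≡ 1ℤ
    at (inj₁ refl) =
      cong₂ _+_ (𝟙-yes refl (p ≟Σ p)) (𝟙-no (pick≢drop q₀ q₀ ∘ sym) (drop A q₀ ≟Σ p))
    at (inj₂ refl) =
      cong₂ _+_ (𝟙-no (pick≢drop q₀ q₀) (pick A q₀ ≟Σ p)) (𝟙-yes refl (p ≟Σ p))

  x-pick : ∀ q → x (actAt S (pick A q)) ≡ 1ℤ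
  x-pick q with uniform (tourOf (pick A q)) (proj₂ (pick A q)) | proj₁ (pickOK A q)
  ... | inj₁ x≡1 | _ = x≡1
  ... | inj₂ x≡-1 | 0<x = contradiction (subst (0ℤ <_) x≡-1 0<x) λ ()

  x-drop : ∀ q → x (actAt S (drop A q)) ≡ -1ℤ
  x-drop q with uniform (tourOf (drop A q)) (proj₂ (drop A q)) | proj₁ (dropOK A q)
  ... | inj₁ x≡1 | x<0 = contradiction (subst (_< 0ℤ) x≡1 x<0) λ { (+<+ ()) }
  ... | inj₂ x≡-1 | _ = x≡-1

  Gs? : ∀ i j → Dec (Gs i j)
  Gs? i j with i ≟ j
  ... | yes i≡j = no λ { (_ , _ , _ , i≢j) → i≢j i≡j }
  ... | no i≢j with any? (λ q → (tourOf (pick A q) ≟ i) ×-dec (tourOf (drop A q) ≟ j))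
  ... | yes (q , p≡i , d≡j) = yes (q , p≡i , d≡j , i≢j)
  ... | no none = no λ { (q , p≡i , d≡j , _) → none (q , p≡i , d≡j) }

  forwardClosed⇒backwardClosed : ∀ R → ForwardClosed Gs R → BackwardClosed Gs R
  forwardClosed⇒backwardClosed R closed (q , refl , refl , _) =
    unitPair≡0⇒ (inR (pick A q)) (inR (drop A q)) (nonpositive-sum≡0⇒≡0 pair≤0 pairs≡0 q)
    where
    inR : ∀ p → Dec (tourOf p ∈ R)
    inR p = tourOf p ∈? R
    weight : ActPos S → ℤ
    weight p = 𝟙 (inR p) * x (actAt S p)
    pair : ∀ q → weight (pick A q) + weight (drop A q) ≡ unitPair (inR (pick A q)) (inR (drop A q))
    pair q = cong₂ (λ a b → 𝟙 (inR (pick A q)) * a + 𝟙 (inR (drop A q)) * b) (x-pick q) (x-drop q)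
    pairs≡0 : ∑[ q < r ] unitPair (inR (pick A q)) (inR (drop A q)) ≡ 0ℤ
    pairs≡0 = begin
      ∑[ q < r ] unitPair (inR (pick A q)) (inR (drop A q))
        ≡⟨ sum-cong-≗ pair ⟨
      ∑[ q < r ] (weight (pick A q) + weight (drop A q))
        ≡⟨ ∑Σ-reindex (pick A) (drop A) assigned-once weight ⟨
      ∑Σ weight
        ≡⟨ sum-cong-≗ (λ j → *-distribˡ-sum (𝟙 (j ∈? R)) (λ i → x (act S j i))) ⟨
      ∑[ j < k ] tourWeight j
        ≡⟨ sum-zero tourWeight tourWeight≡0 ⟩
      0ℤ
        ∎
      where
      open ≡-Reasoning
      tourWeight : Fin k → ℤ
      tourWeight j = 𝟙 (j ∈? R) * ∑[ i < nA S j ] x (act S j i)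
      tourWeight≡0 : ∀ j → tourWeight j ≡ 0ℤ
      tourWeight≡0 j = trans (cong (𝟙 (j ∈? R) *_) (tour-balanced j)) (ℤ.*-zeroʳ (𝟙 (j ∈? R)))
    pair≤0 : ∀ q → unitPair (inR (pick A q)) (inR (drop A q)) ≤ 0ℤ
    pair≤0 q with tourOf (pick A q) ≟ tourOf (drop A q)
    ... | yes same = unitPair≤0 (subst (_∈ R) same) (inR (pick A q)) (inR (drop A q))
    ... | no differ = unitPair≤0 (closed (q , refl , refl , differ)) (inR (pick A q)) (inR (drop A q))

  reverseGs : ∀ {i j} → Gs i j → Star Gs j i
  reverseGs = forwardClosed⇒backwardClosed⇒reversible Gs Gs? forwardClosed⇒backwardClosed

  withinTour : ∀ j a b → Star Gtm (j , a) (j , b)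
  withinTour j a b = gmap (j ,_) id (cycle-stronglyConnected {E = λ a b → Gtm (j , a) (j , b)}
    (λ i i≡0 → inj₁ (depot→first j i i≡0))
    (λ i i′ i′≡1+i → inj₁ (consecutive j i i′ i′≡1+i))
    (λ i 1+i≡n → inj₁ (last→depot j i 1+i≡n)) a b)

  liftGs : ∀ {i j} → Star Gs i j → ∀ a b → Star Gtm (i , a) (j , b)
  liftGs ε a b = withinTour _ a b
  liftGs ((q , refl , refl , _) ◅ path) a b =
    withinTour _ a (just (proj₂ (pick A q))) ◅◅
    (inj₂ (q , refl , refl) ◅ liftGs path (just (proj₂ (drop A q))) b)

  reverseGtm : ∀ {u w} → Gtm u w → Star Gtm w u
  reverseGtm (inj₁ (depot→first j _ _)) = withinTour j _ _
  reverseGtm (inj₁ (consecutive j _ _ _)) = withinTour j _ _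
  reverseGtm (inj₁ (last→depot j _ _)) = withinTour j _ _
  reverseGtm (inj₂ (q , refl , refl)) = liftGs dropTour⇝pickTour _ _
    where
    dropTour⇝pickTour : Star Gs (tourOf (drop A q)) (tourOf (pick A q))
    dropTour⇝pickTour with tourOf (pick A q) ≟ tourOf (drop A q)
    ... | yes same = subst (λ j → Star Gs j (tourOf (pick A q))) same ε
    ... | no differ = reverseGs (q , refl , refl , differ)

lemma5 : {V : Set} (L k : ℕ) (S : Schedule V L k) → Uniform S →
         (r : ℕ) (TR : Fin r → V × V) (A : Assignment S r TR) →
         ComponentsStronglyConnected (GsArc S A) ×
         (AllBackhaul S → ComponentsStronglyConnected (GtmArc S A))
lemma5 L k S uniform r TR A =
  reversible⇒componentsStronglyConnected (GsArc S A) reverseGs ,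
  λ _ → reversible⇒componentsStronglyConnected (GtmArc S A) reverseGtm
  where open Transport S uniform A
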